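{- Let $G$ be a finite abelian $p$-group of exponent $p^e$ ($e\ge1$), $r_i(G)=\log_p[p^{i-1}G:p^iG]$, $\alpha_p(G)=\big(1+(p-1)\sum_{i=1}^e p^{e-i}r_i(G)\big)/p^e$, and $w_i(l)=\lfloor (l-1)/p^{i-1}\rfloor-\lfloor (l-1)/p^i\rfloor$. For an integer $2\le l\le p^e$ let $$\varepsilon(l)=\alpha_p(G)-\frac{1+\sum_{i=1}^e r_i(G)w_i(l)}{l},$$ and let $0\le f\le e$ be the minimal integer such that $p^fG$ is cyclic. Then $\varepsilon(l)\ge0$, with $\varepsilon(l)=0$ if and only if $p^f\mid l$. -}

module Defs where

open import Data.Nat using (ℕ; zero; suc; _+_; _*_; _∸_; _^_)
open import Data.Nat.DivMod using (_/_)
open import Data.Fin using (Fin; _≟_)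
open import Data.Fin.Properties using (any?)
open import Data.List using (List; length; filter)
open import Data.List.Base using (allFin)
open import Data.Product using (Σ; ∃; _×_)
open import Data.Integer using (+_)
open import Data.Rational as ℚ using (ℚ; 0ℚ)
open import Relation.Binary.PropositionalEquality using (_≡_)
open import Relation.Nullary using (Dec)
open import Algebra.Structures using (IsAbelianGroup)

-- A finite abelian group: carrier Fin order (every finite group is isomorphic
-- to one of this form), equality is propositional equality.
record FinAbGroup : Set where
  field
    order : ℕ
    _∙_   : Fin order → Fin order → Fin order
    e0    : Fin order
    _⁻¹   : Fin order → Fin order
    isAbelianGroup : IsAbelianGroup _≡_ _∙_ e0 _⁻¹

  _·_ : ℕ → Fin order → Fin order
  zero · x = e0
  suc k · x = x ∙ (k · x)

  _∈mul_ : Fin order → ℕ → Set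
  x ∈mul m = ∃ λ y → x ≡ m · y

  _∈mul?_ : ∀ x m → Dec (x ∈mul m)
  x ∈mul? m = any? (λ y → x ≟ m · y)

  cardMul : ℕ → ℕ
  cardMul m = length (filter (λ x → x ∈mul? m) (allFin order))

  MulCyclic : ℕ → Set
  MulCyclic m = Σ (Fin order) λ g → g ∈mul m × (∀ x → x ∈mul m → ∃ λ k → x ≡ k · g)

  HasExponent : ℕ → Set
  HasExponent n = (∀ x → n · x ≡ e0) × (∀ k → 0 Data.Nat.< k → (∀ x → k · x ≡ e0) → n Data.Nat.≤ k)

open FinAbGroup public

sum1to : ℕ → (ℕ → ℕ) → ℕ
sum1to zero f = 0
sum1to (suc e) f = sum1to e f + f (suc e)

-- total floor division (divisor 0 ↦ 0; only used with divisor p^k ≥ 1)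
⌊_/_⌋ : ℕ → ℕ → ℕ
⌊ m / zero ⌋ = 0
⌊ m / suc d ⌋ = m / suc d

-- rational n/d (denominator 0 ↦ 0; only used with d ≥ 1)
_÷_ : ℕ → ℕ → ℚ
n ÷ zero = 0ℚ
n ÷ suc d = (+ n) ℚ./ suc d

w : ℕ → ℕ → ℕ → ℕ
w p i l = ⌊ (l ∸ 1) / p ^ (i ∸ 1) ⌋ ∸ ⌊ (l ∸ 1) / p ^ i ⌋

α : ℕ → ℕ → (ℕ → ℕ) → ℚ
α p e r = (1 + (p ∸ 1) * sum1to e (λ i → p ^ (e ∸ i) * r i)) ÷ (p ^ e)

εfun : ℕ → ℕ → (ℕ → ℕ) → ℕ → ℚ
εfun p e r l = α p e r ℚ.- ((1 + sum1to e (λ i → r i * w p i l)) ÷ l)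

{-# OPTIONS --safe #-}
module Submission where

-- Put P = p^e. The partial sums W_j = Σ_{i≤j} w_i(l) = (l-1) - ⌊(l-1)/p^j⌋ and X_j = Σ_{i≤j} p^{e-i}
-- satisfy l (p-1) X_j = P W_j + p^{e-j} (p^j ⌈l/p^j⌉ - l), so summation by parts against r gives
--
--   P l ε(l) = Σ_{j<e} (r_j - r_{j+1}) p^{e-j} (p^j ⌈l/p^j⌉ - l) + (r_e - 1) (P - l).
--
-- In a p-group, p^{r_i} is the number of elements of p^{i-1}G killed by p, so r is non-increasing,
-- and r_e ≥ 1; hence every term is non-negative. Minimality of f gives r_f ≥ 2 (if r_f = 1 then
-- p^{f-1}G has index p over p^fG and is therefore cyclic), and cyclicity of p^fG gives r_{f+1} ≤ 1.
-- So the terms beyond f vanish, and the sum is zero exactly when p^f divides l.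

open import Defs hiding (order; _∙_; e0; _⁻¹; isAbelianGroup; _·_; _∈mul_; _∈mul?_)
open import Data.Nat hiding (_≟_)
open import Data.Nat.Properties hiding (_≟_)
open import Data.Nat.DivMod
open import Data.Nat.Divisibility
open import Data.Nat.Primality using (Prime; prime⇒nonZero; prime⇒nonTrivial)
open import Data.Nat.Coprimality using (Coprime; coprime-Bézout; prime⇒coprime)
open import Data.Nat.GCD using (module Bézout)
open import Data.Nat.Solver using (module +-*-Solver)
open import Data.Integer as ℤ using (_⊖_)
import Data.Integer.Properties as ℤP
open import Data.Rational as ℚ using (0ℚ)
import Data.Rational.Properties as ℚP
open import Data.Rational.Unnormalised as ℚᵘ using (mkℚᵘ; *≡*)
import Data.Rational.Unnormalised.Properties as ℚᵘP
open import Data.Fin using (Fin; zero; suc; toℕ; fromℕ<; combine; remQuot)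
open import Data.Fin.Properties
  using (_≟_; any?; ¬∀⟶∃¬; toℕ<n; toℕ-injective; toℕ-fromℕ<; injective⇒≤; remQuot-combine; combine-remQuot)
open import Data.List using (List; length; filter; lookup)
open import Data.List.Base using (allFin)
import Data.List.Relation.Unary.All as All
open import Data.List.Relation.Unary.AllPairs using (_∷_)
open import Data.List.Relation.Unary.Any using (index)
open import Data.List.Relation.Unary.Any.Properties using (lookup-index)
open import Data.List.Relation.Unary.Unique.Propositional using (Unique)
open import Data.List.Relation.Unary.Unique.Propositional.Properties using (allFin⁺; filter⁺)
open import Data.List.Membership.Propositional.Properties using (∈-filter⁺; ∈-filter⁻; ∈-allFin; ∈-lookup)
open import Data.Product using (_×_; _,_; ∃; proj₁; proj₂; uncurry)
open import Data.Sum using (inj₁; inj₂)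
open import Data.Empty using (⊥-elim)
open import Level using (0ℓ)
open import Algebra.Bundles using (AbelianGroup)
open import Function.Bundles using (_⇔_; mk⇔; Equivalence)
open import Function.Construct.Composition using (_⇔-∘_)
open import Relation.Nullary using (¬_; yes; no; ¬?; contradiction)
open import Relation.Nullary.Decidable using (_×-dec_)
open import Relation.Unary using (Pred; Decidable)
open import Relation.Binary.Definitions using (tri<; tri≈; tri>)
open import Relation.Binary.PropositionalEquality
open +-*-Solver

÷-nonNeg : ∀ n d → 0ℚ ℚ.≤ n ÷ d
÷-nonNeg n zero    = ℚP.≤-refl
÷-nonNeg n (suc d) = ℚP.nonNegative⁻¹ _ {{ℚP.normalize-nonNeg n (suc d)}}

÷≡0⇒≡0 : ∀ n d → n ÷ suc d ≡ 0ℚ → n ≡ 0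
÷≡0⇒≡0 zero    d _  = refl
÷≡0⇒≡0 (suc n) d eq = ⊥-elim (ℚP.<-irrefl (sym eq) (ℚP.positive⁻¹ _ {{ℚP.normalize-pos (suc n) (suc d)}}))

÷≡0⇔≡0 : ∀ n d .{{_ : NonZero d}} → n ÷ d ≡ 0ℚ ⇔ n ≡ 0
÷≡0⇔≡0 n (suc d) = mk⇔ (÷≡0⇒≡0 n d) λ { refl → ℚP.0/n≡0 (suc d) }

÷-minus-÷ : ∀ A B a b G .{{_ : NonZero a}} .{{_ : NonZero b}} → A * b ≡ B * a + G →
            A ÷ a ℚ.- B ÷ b ≡ G ÷ (a * b)
÷-minus-÷ A B (suc a) (suc b) G eq = ℚP.toℚᵘ-injective difference
  where
  X : ℚᵘ.ℚᵘ
  X = mkℚᵘ (ℤ.+ A) a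
  Y : ℚᵘ.ℚᵘ
  Y = mkℚᵘ (ℤ.+ B) b

  numerator : ℤ.+ A ℤ.* ℤ.+ suc b ℤ.+ ℤ.- (ℤ.+ B) ℤ.* ℤ.+ suc a ≡ ℤ.+ G
  numerator = begin
    ℤ.+ A ℤ.* ℤ.+ suc b ℤ.+ ℤ.- (ℤ.+ B) ℤ.* ℤ.+ suc a
      ≡⟨ cong (λ z → ℤ.+ A ℤ.* ℤ.+ suc b ℤ.+ z) (ℤP.neg-distribˡ-* (ℤ.+ B) (ℤ.+ suc a)) ⟨
    ℤ.+ A ℤ.* ℤ.+ suc b ℤ.- ℤ.+ B ℤ.* ℤ.+ suc a
      ≡⟨ cong₂ ℤ._-_ (ℤP.pos-* A (suc b)) (ℤP.pos-* B (suc a)) ⟨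
    ℤ.+ (A * suc b) ℤ.- ℤ.+ (B * suc a)   ≡⟨ ℤP.m-n≡m⊖n (A * suc b) (B * suc a) ⟩
    (A * suc b) ⊖ (B * suc a)             ≡⟨ cong (_⊖ (B * suc a)) eq ⟩
    (B * suc a + G) ⊖ (B * suc a)         ≡⟨ ℤP.⊖-≥ (m≤m+n (B * suc a) G) ⟩
    ℤ.+ (B * suc a + G ∸ B * suc a)       ≡⟨ cong ℤ.+_ (m+n∸m≡n (B * suc a) G) ⟩
    ℤ.+ G                                 ∎
    where open ≡-Reasoning

  difference : ℚ.toℚᵘ (A ÷ suc a ℚ.- B ÷ suc b) ℚᵘ.≃ ℚ.toℚᵘ (G ÷ (suc a * suc b))
  difference = begin
    ℚ.toℚᵘ (A ÷ suc a ℚ.- B ÷ suc b)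
      ≈⟨ ℚP.toℚᵘ-homo-+ (A ÷ suc a) (ℚ.- (B ÷ suc b)) ⟩
    ℚ.toℚᵘ (A ÷ suc a) ℚᵘ.+ ℚ.toℚᵘ (ℚ.- (B ÷ suc b))
      ≈⟨ ℚᵘP.+-cong (ℚP.toℚᵘ-fromℚᵘ X) (ℚᵘP.≃-trans (ℚP.toℚᵘ-homo‿- (B ÷ suc b)) (ℚᵘP.-‿cong (ℚP.toℚᵘ-fromℚᵘ Y))) ⟩
    X ℚᵘ.- Y
      ≈⟨ *≡* (cong (ℤ._* ℤ.+ (suc a * suc b)) numerator) ⟩
    mkℚᵘ (ℤ.+ G) (b + a * suc b)
      ≈⟨ ℚᵘP.≃-sym (ℚP.toℚᵘ-fromℚᵘ _) ⟩
    ℚ.toℚᵘ (G ÷ (suc a * suc b)) ∎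
    where open ℚᵘP.≃-Reasoning

-- Sums and powers of natural numbers

sum1to-cong : ∀ n {f g : ℕ → ℕ} → (∀ i → 1 ≤ i → i ≤ n → f i ≡ g i) → sum1to n f ≡ sum1to n g
sum1to-cong zero    f≗g = refl
sum1to-cong (suc n) f≗g =
  cong₂ _+_ (sum1to-cong n (λ i 1≤i i≤n → f≗g i 1≤i (m≤n⇒m≤1+n i≤n))) (f≗g (suc n) (s≤s z≤n) ≤-refl)

sum1to-distrib-+ : ∀ n f g → sum1to n (λ i → f i + g i) ≡ sum1to n f + sum1to n g
sum1to-distrib-+ zero    f g = refl
sum1to-distrib-+ (suc n) f g rewrite sum1to-distrib-+ n f g =
  solve 4 (λ a b c d → (a :+ b) :+ (c :+ d) := (a :+ c) :+ (b :+ d)) refl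
    (sum1to n f) (sum1to n g) (f (suc n)) (g (suc n))

sum1to-*-distribˡ : ∀ n c f → sum1to n (λ i → c * f i) ≡ c * sum1to n f
sum1to-*-distribˡ zero    c f = sym (*-zeroʳ c)
sum1to-*-distribˡ (suc n) c f rewrite sum1to-*-distribˡ n c f = sym (*-distribˡ-+ c (sum1to n f) (f (suc n)))

sum1to≡0⇒ : ∀ n f → sum1to n f ≡ 0 → ∀ i → 1 ≤ i → i ≤ n → f i ≡ 0
sum1to≡0⇒ zero    f eq (suc i) 1≤i ()
sum1to≡0⇒ (suc n) f eq i 1≤i i≤1+n with m≤n⇒m<n∨m≡n i≤1+n
... | inj₁ (s≤s i≤n) = sum1to≡0⇒ n f (m+n≡0⇒m≡0 _ eq) i 1≤i i≤n
... | inj₂ refl      = m+n≡0⇒n≡0 (sum1to n f) eq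

sum1to-zero : ∀ n f → (∀ i → 1 ≤ i → i ≤ n → f i ≡ 0) → sum1to n f ≡ 0
sum1to-zero zero    f f≗0 = refl
sum1to-zero (suc n) f f≗0 =
  cong₂ _+_ (sum1to-zero n f (λ i 1≤i i≤n → f≗0 i 1≤i (m≤n⇒m≤1+n i≤n))) (f≗0 (suc n) (s≤s z≤n) ≤-refl)

sum1to-telescope : ∀ (s : ℕ → ℕ) → (∀ i → s (suc i) ≤ s i) → ∀ n →
                   sum1to n (λ i → s (i ∸ 1) ∸ s i) + s n ≡ s 0
sum1to-telescope s s-antitone zero    = refl
sum1to-telescope s s-antitone (suc n) = begin
  D + (s n ∸ s (suc n)) + s (suc n)   ≡⟨ +-assoc D _ _ ⟩
  D + (s n ∸ s (suc n) + s (suc n))   ≡⟨ cong (D +_) (m∸n+n≡m (s-antitone n)) ⟩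
  D + s n                             ≡⟨ sum1to-telescope s s-antitone n ⟩
  s 0                                 ∎
  where
  open ≡-Reasoning
  D : ℕ
  D = sum1to n (λ i → s (i ∸ 1) ∸ s i)

summation-by-parts : ∀ (r x : ℕ → ℕ) n → (∀ j → 1 ≤ j → j ≤ n → r (suc j) ≤ r j) →
  sum1to (suc n) (λ i → r i * x i) ≡
  sum1to n (λ j → (r j ∸ r (suc j)) * sum1to j x) + r (suc n) * sum1to (suc n) x
summation-by-parts r x zero    r-antitone = refl
summation-by-parts r x (suc n) r-antitone = begin
  sum1to (suc n) (λ i → r i * x i) + r n₂ * x n₂
    ≡⟨ cong (_+ r n₂ * x n₂) (summation-by-parts r x n (λ j 1≤j j≤n → r-antitone j 1≤j (m≤n⇒m≤1+n j≤n))) ⟩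
  D + r n₁ * X + r n₂ * x n₂
    ≡⟨ cong (λ t → D + t * X + r n₂ * x n₂) (sym (m∸n+n≡m (r-antitone n₁ (s≤s z≤n) ≤-refl))) ⟩
  D + (δ + r n₂) * X + r n₂ * x n₂
    ≡⟨ solve 5 (λ D δ ρ X y → D :+ (δ :+ ρ) :* X :+ ρ :* y := D :+ δ :* X :+ ρ :* (X :+ y)) refl D δ (r n₂) X (x n₂) ⟩
  D + δ * X + r n₂ * (X + x n₂)   ∎
  where
  open ≡-Reasoning
  n₁ : ℕ
  n₁ = suc n
  n₂ : ℕ
  n₂ = suc n₁
  D : ℕ
  D = sum1to n (λ j → (r j ∸ r (suc j)) * sum1to j x)
  X : ℕ
  X = sum1to n₁ x
  δ : ℕ
  δ = r n₁ ∸ r n₂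

antitone-chain : ∀ (r : ℕ → ℕ) n → (∀ j → 1 ≤ j → j ≤ n → r (suc j) ≤ r j) →
                 ∀ {i j} → 1 ≤ i → i ≤ j → j ≤ suc n → r j ≤ r i
antitone-chain r n r-antitone {i} {j} 1≤i i≤j j≤1+n with m≤n⇒m<n∨m≡n i≤j
... | inj₂ refl = ≤-refl
antitone-chain r n r-antitone {i} {suc j} 1≤i _ (s≤s j≤n) | inj₁ (s≤s i≤j) =
  ≤-trans (r-antitone j (≤-trans 1≤i i≤j) j≤n) (antitone-chain r n r-antitone 1≤i i≤j (m≤n⇒m≤1+n j≤n))

^-monoʳ-∣ : ∀ m {i j} → i ≤ j → m ^ i ∣ m ^ j
^-monoʳ-∣ m {i} {j} i≤j = divides (m ^ (j ∸ i))
  (trans (cong (m ^_) (sym (m∸n+n≡m i≤j))) (^-distribˡ-+-* m (j ∸ i) i))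

^-cancelʳ-≤ : ∀ m {a b} → 1 < m → m ^ a ≤ m ^ b → a ≤ b
^-cancelʳ-≤ m 1<m mᵃ≤mᵇ = ≮⇒≥ (λ b<a → <⇒≱ (^-monoʳ-< m 1<m b<a) mᵃ≤mᵇ)

-- The defect P l ε(l)

⌊⌋≡/ : ∀ m d .{{_ : NonZero d}} → ⌊ m / d ⌋ ≡ m / d
⌊⌋≡/ m (suc d) = refl

-- d ⌈l / d⌉, for l ≥ 1
roundUp : ℕ → ℕ → ℕ
roundUp d l = d * suc ⌊ (l ∸ 1) / d ⌋

≤-roundUp : ∀ d l .{{_ : NonZero d}} → l ≤ roundUp d l
≤-roundUp d zero    = z≤n
≤-roundUp d (suc l) = begin
  suc l                     ≡⟨ cong suc (m≡m%n+[m/n]*n l d) ⟩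
  suc (l % d + l / d * d)   ≤⟨ +-monoˡ-≤ (l / d * d) (m%n<n l d) ⟩
  d + l / d * d             ≡⟨ cong (d +_) (*-comm (l / d) d) ⟩
  d + d * (l / d)           ≡⟨ sym (*-suc d (l / d)) ⟩
  d * suc (l / d)           ≡⟨ cong (λ q → d * suc q) (sym (⌊⌋≡/ l d)) ⟩
  roundUp d (suc l)         ∎
  where open ≤-Reasoning

roundUp∸≡0⇔∣ : ∀ d l .{{_ : NonZero d}} .{{_ : NonZero l}} → roundUp d l ∸ l ≡ 0 ⇔ d ∣ l
roundUp∸≡0⇔∣ d (suc l) = mk⇔ to from
  where
  q : ℕ
  q = ⌊ l / d ⌋

  to : roundUp d (suc l) ∸ suc l ≡ 0 → d ∣ suc l
  to h = divides (suc q) (trans (≤-antisym (≤-roundUp d (suc l)) (m∸n≡0⇒m≤n h)) (*-comm d (suc q)))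

  from : d ∣ suc l → roundUp d (suc l) ∸ suc l ≡ 0
  from (divides c l≡c*d) = m≤n⇒m∸n≡0 (begin
    d * suc q   ≤⟨ *-monoʳ-≤ d (*-cancelʳ-< d q c q*d<c*d) ⟩
    d * c       ≡⟨ *-comm d c ⟩
    c * d       ≡⟨ sym l≡c*d ⟩
    suc l       ∎)
    where
    open ≤-Reasoning
    q*d<c*d : q * d < c * d
    q*d<c*d = begin-strict
      q * d     ≡⟨ cong (_* d) (⌊⌋≡/ l d) ⟩
      l / d * d ≤⟨ m/n*n≤m l d ⟩
      l         <⟨ n<1+n l ⟩
      suc l     ≡⟨ l≡c*d ⟩
      c * d     ∎

module WeightSums (p : ℕ) .{{_ : NonZero p}} (e l : ℕ) .{{_ : NonZero l}} where

  W : ℕ → ℕ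
  W j = sum1to j (λ i → w p i l)

  X : ℕ → ℕ
  X j = sum1to j (λ i → p ^ (e ∸ i))

  gap : ℕ → ℕ
  gap j = roundUp (p ^ j) l ∸ l

  W+⌊⌋≡l∸1 : ∀ j → W j + ⌊ (l ∸ 1) / p ^ j ⌋ ≡ l ∸ 1
  W+⌊⌋≡l∸1 j = trans (sum1to-telescope s s-antitone j) (n/1≡n (l ∸ 1))
    where
    s : ℕ → ℕ
    s i = ⌊ (l ∸ 1) / p ^ i ⌋
    s-antitone : ∀ i → s (suc i) ≤ s i
    s-antitone i = subst₂ _≤_ (sym (⌊⌋≡/ (l ∸ 1) (p ^ suc i) {{m^n≢0 p (suc i)}}))
                              (sym (⌊⌋≡/ (l ∸ 1) (p ^ i) {{m^n≢0 p i}}))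
                              (/-monoʳ-≤ (l ∸ 1) {{m^n≢0 p (suc i)}} {{m^n≢0 p i}} (^-monoʳ-≤ p (n≤1+n i)))

  geometric-sum : ∀ j → j ≤ e → (p ∸ 1) * X j + p ^ (e ∸ j) ≡ p ^ e
  geometric-sum zero    _   = cong (_+ p ^ e) (*-zeroʳ (p ∸ 1))
  geometric-sum (suc j) j<e = begin
    (p ∸ 1) * (X j + t) + t
      ≡⟨ solve 3 (λ a b c → a :* (b :+ c) :+ c := a :* b :+ (a :+ con 1) :* c) refl (p ∸ 1) (X j) t ⟩
    (p ∸ 1) * X j + (p ∸ 1 + 1) * t
      ≡⟨ cong (λ z → (p ∸ 1) * X j + z * t) (m∸n+n≡m (>-nonZero⁻¹ p)) ⟩
    (p ∸ 1) * X j + p ^ suc (e ∸ suc j)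
      ≡⟨ cong (λ z → (p ∸ 1) * X j + p ^ z) (+-∸-assoc 1 j<e) ⟨
    (p ∸ 1) * X j + p ^ (e ∸ j)
      ≡⟨ geometric-sum j (<⇒≤ j<e) ⟩
    p ^ e ∎
    where
    open ≡-Reasoning
    t : ℕ
    t = p ^ (e ∸ suc j)

  l*[p-1]*X≡pᵉ*W+gap : ∀ j → j ≤ e → l * ((p ∸ 1) * X j) ≡ p ^ e * W j + p ^ (e ∸ j) * gap j
  l*[p-1]*X≡pᵉ*W+gap j j≤e = +-cancelʳ-≡ T _ _ (begin
    l * ((p ∸ 1) * X j) + T
      ≡⟨ solve 3 (λ l a c → l :* a :+ c :* l := l :* (a :+ c)) refl l ((p ∸ 1) * X j) pᵉ⁻ʲ ⟩
    l * ((p ∸ 1) * X j + pᵉ⁻ʲ)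
      ≡⟨ cong (l *_) (geometric-sum j j≤e) ⟩
    l * p ^ e
      ≡⟨ *-comm l (p ^ e) ⟩
    p ^ e * l
      ≡⟨ cong (p ^ e *_) l≡W+q+1 ⟩
    p ^ e * (W j + q + 1)
      ≡⟨ cong (λ z → z * (W j + q + 1)) pᵉ⁻ʲ*pʲ≡pᵉ ⟨
    pᵉ⁻ʲ * p ^ j * (W j + q + 1)
      ≡⟨ solve 4 (λ a b w q → a :* b :* (w :+ q :+ con 1) := a :* b :* w :+ a :* (b :* (con 1 :+ q)))
                 refl pᵉ⁻ʲ (p ^ j) (W j) q ⟩
    pᵉ⁻ʲ * p ^ j * W j + pᵉ⁻ʲ * roundUp (p ^ j) l
      ≡⟨ cong₂ (λ a b → a * W j + pᵉ⁻ʲ * b) pᵉ⁻ʲ*pʲ≡pᵉ (sym (m∸n+n≡m (≤-roundUp (p ^ j) l {{m^n≢0 p j}}))) ⟩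
    p ^ e * W j + pᵉ⁻ʲ * (gap j + l)
      ≡⟨ solve 5 (λ a w b g l → a :* w :+ b :* (g :+ l) := a :* w :+ b :* g :+ b :* l) refl (p ^ e) (W j) pᵉ⁻ʲ (gap j) l ⟩
    p ^ e * W j + pᵉ⁻ʲ * gap j + T ∎)
    where
    open ≡-Reasoning
    pᵉ⁻ʲ : ℕ
    pᵉ⁻ʲ = p ^ (e ∸ j)
    T : ℕ
    T = pᵉ⁻ʲ * l
    q : ℕ
    q = ⌊ (l ∸ 1) / p ^ j ⌋
    pᵉ⁻ʲ*pʲ≡pᵉ : pᵉ⁻ʲ * p ^ j ≡ p ^ e
    pᵉ⁻ʲ*pʲ≡pᵉ = trans (sym (^-distribˡ-+-* p (e ∸ j) j)) (cong (p ^_) (m∸n+n≡m j≤e))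
    l≡W+q+1 : l ≡ W j + q + 1
    l≡W+q+1 = trans (sym (m∸n+n≡m (>-nonZero⁻¹ l))) (cong (_+ 1) (sym (W+⌊⌋≡l∸1 j)))

  gap[e]≡pᵉ∸l : l ≤ p ^ e → gap e ≡ p ^ e ∸ l
  gap[e]≡pᵉ∸l l≤pᵉ = cong (_∸ l) (trans (cong (λ q → p ^ e * suc q) q≡0) (*-identityʳ (p ^ e)))
    where
    q≡0 : ⌊ (l ∸ 1) / p ^ e ⌋ ≡ 0
    q≡0 = trans (⌊⌋≡/ (l ∸ 1) (p ^ e) {{m^n≢0 p e}})
                (m<n⇒m/n≡0 {{m^n≢0 p e}} (<-≤-trans (∸-monoʳ-< z<s (>-nonZero⁻¹ l)) l≤pᵉ))

  l*[p-1]*Xₑ≡pᵉ*Wₑ+pᵉ∸l : l ≤ p ^ e → l * ((p ∸ 1) * X e) ≡ p ^ e * W e + (p ^ e ∸ l)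
  l*[p-1]*Xₑ≡pᵉ*Wₑ+pᵉ∸l l≤pᵉ = begin
    l * ((p ∸ 1) * X e)                     ≡⟨ l*[p-1]*X≡pᵉ*W+gap e ≤-refl ⟩
    p ^ e * W e + p ^ (e ∸ e) * gap e       ≡⟨ cong (λ z → p ^ e * W e + p ^ z * gap e) (n∸n≡0 e) ⟩
    p ^ e * W e + 1 * gap e                 ≡⟨ cong (p ^ e * W e +_) (trans (*-identityˡ (gap e)) (gap[e]≡pᵉ∸l l≤pᵉ)) ⟩
    p ^ e * W e + (p ^ e ∸ l)               ∎
    where open ≡-Reasoning

module Defect (p : ℕ) .{{_ : NonZero p}} (e′ l : ℕ) .{{_ : NonZero l}} (l≤pᵉ : l ≤ p ^ suc e′)
              (r : ℕ → ℕ) (r-antitone : ∀ j → 1 ≤ j → j ≤ e′ → r (suc j) ≤ r j) (1≤rₑ : 1 ≤ r (suc e′)) where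

  e : ℕ
  e = suc e′
  open WeightSums p e l public

  Δr : ℕ → ℕ
  Δr j = r j ∸ r (suc j)

  ΣΔr*X ΣΔr*W Σgap : ℕ
  ΣΔr*X = sum1to e′ (λ j → Δr j * X j)
  ΣΔr*W = sum1to e′ (λ j → Δr j * W j)
  Σgap  = sum1to e′ (λ j → Δr j * (p ^ (e ∸ j) * gap j))

  defect : ℕ
  defect = Σgap + (r e ∸ 1) * (p ^ e ∸ l)

  l*[p-1]*ΣΔr*X≡ : l * ((p ∸ 1) * ΣΔr*X) ≡ p ^ e * ΣΔr*W + Σgap
  l*[p-1]*ΣΔr*X≡ = begin
    l * (c * ΣΔr*X)
      ≡⟨ *-assoc l c ΣΔr*X ⟨
    l * c * ΣΔr*X
      ≡⟨ sum1to-*-distribˡ e′ (l * c) (λ j → Δr j * X j) ⟨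
    sum1to e′ (λ j → l * c * (Δr j * X j))
      ≡⟨ sum1to-cong e′ (λ j _ j≤e′ → per-term j (m≤n⇒m≤1+n j≤e′)) ⟩
    sum1to e′ (λ j → p ^ e * (Δr j * W j) + Δr j * (p ^ (e ∸ j) * gap j))
      ≡⟨ sum1to-distrib-+ e′ _ _ ⟩
    sum1to e′ (λ j → p ^ e * (Δr j * W j)) + Σgap
      ≡⟨ cong (_+ Σgap) (sum1to-*-distribˡ e′ (p ^ e) (λ j → Δr j * W j)) ⟩
    p ^ e * ΣΔr*W + Σgap ∎
    where
    open ≡-Reasoning
    c : ℕ
    c = p ∸ 1
    per-term : ∀ j → j ≤ e → l * c * (Δr j * X j) ≡ p ^ e * (Δr j * W j) + Δr j * (p ^ (e ∸ j) * gap j)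
    per-term j j≤e = begin
      l * c * (Δr j * X j)
        ≡⟨ solve 4 (λ l c d x → l :* c :* (d :* x) := d :* (l :* (c :* x))) refl l c (Δr j) (X j) ⟩
      Δr j * (l * (c * X j))
        ≡⟨ cong (Δr j *_) (l*[p-1]*X≡pᵉ*W+gap j j≤e) ⟩
      Δr j * (p ^ e * W j + p ^ (e ∸ j) * gap j)
        ≡⟨ solve 4 (λ d P w g → d :* (P :* w :+ g) := P :* (d :* w) :+ d :* g) refl (Δr j) (p ^ e) (W j) (p ^ (e ∸ j) * gap j) ⟩
      p ^ e * (Δr j * W j) + Δr j * (p ^ (e ∸ j) * gap j) ∎

  A*l≡B*pᵉ+defect : (1 + (p ∸ 1) * sum1to e (λ i → p ^ (e ∸ i) * r i)) * l
                  ≡ (1 + sum1to e (λ i → r i * w p i l)) * p ^ e + defect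
  A*l≡B*pᵉ+defect = begin
    (1 + c * ΣrX) * l
      ≡⟨ solve 2 (λ a b → (con 1 :+ a) :* b := b :+ b :* a) refl (c * ΣrX) l ⟩
    l + l * (c * ΣrX)
      ≡⟨ cong (λ z → l + l * (c * z)) ΣrX≡ ⟩
    l + l * (c * (ΣΔr*X + r e * X e))
      ≡⟨ cong (l +_) (solve 5 (λ a b x y z → a :* (b :* (x :+ y :* z)) := a :* (b :* x) :+ y :* (a :* (b :* z)))
                              refl l c ΣΔr*X (r e) (X e)) ⟩
    l + (l * (c * ΣΔr*X) + r e * (l * (c * X e)))
      ≡⟨ cong₂ (λ u v → l + (u + r e * v)) l*[p-1]*ΣΔr*X≡ (l*[p-1]*Xₑ≡pᵉ*Wₑ+pᵉ∸l l≤pᵉ) ⟩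
    F (p ^ e) (r e)
      ≡⟨ cong₂ F (m+[n∸m]≡n l≤pᵉ) (m∸n+n≡m 1≤rₑ) ⟨
    F (l + k) (ρ + 1)
      ≡⟨ solve 6 (λ l k dw gs ρ we →
                    l :+ ((l :+ k) :* dw :+ gs :+ (ρ :+ con 1) :* ((l :+ k) :* we :+ k))
                 := (con 1 :+ (dw :+ (ρ :+ con 1) :* we)) :* (l :+ k) :+ (gs :+ ρ :* k))
                 refl l k ΣΔr*W Σgap ρ (W e) ⟩
    H (l + k) (ρ + 1)
      ≡⟨ cong₂ H (m+[n∸m]≡n l≤pᵉ) (m∸n+n≡m 1≤rₑ) ⟩
    H (p ^ e) (r e)
      ≡⟨ cong (λ z → (1 + z) * p ^ e + defect) ΣrW≡ ⟨
    (1 + ΣrW) * p ^ e + defect ∎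
    where
    open ≡-Reasoning
    c : ℕ
    c = p ∸ 1
    k : ℕ
    k = p ^ e ∸ l
    ρ : ℕ
    ρ = r e ∸ 1
    ΣrX : ℕ
    ΣrX = sum1to e (λ i → p ^ (e ∸ i) * r i)
    ΣrW : ℕ
    ΣrW = sum1to e (λ i → r i * w p i l)
    -- F and H abstract P and r e, so that P = l + (P ∸ l) and r e = (r e ∸ 1) + 1 can be substituted
    -- and the truncated subtractions disappear from the ring identity.
    F H : ℕ → ℕ → ℕ
    F P ρ′ = l + (P * ΣΔr*W + Σgap + ρ′ * (P * W e + k))
    H P ρ′ = (1 + (ΣΔr*W + ρ′ * W e)) * P + (Σgap + ρ * k)

    ΣrX≡ : ΣrX ≡ ΣΔr*X + r e * X e
    ΣrX≡ = trans (sum1to-cong e (λ i _ _ → *-comm (p ^ (e ∸ i)) (r i)))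
                 (summation-by-parts r (λ i → p ^ (e ∸ i)) e′ r-antitone)
    ΣrW≡ : ΣrW ≡ ΣΔr*W + r e * W e
    ΣrW≡ = summation-by-parts r (λ i → w p i l) e′ r-antitone

  εfun≡defect÷pᵉl : εfun p e r l ≡ defect ÷ (p ^ e * l)
  εfun≡defect÷pᵉl = ÷-minus-÷ _ _ (p ^ e) l defect {{m^n≢0 p e}} A*l≡B*pᵉ+defect

  module _ (f : ℕ) (f≤e : f ≤ e) (2≤r[f] : 1 ≤ f → 2 ≤ r f) (r[1+f]≤1 : f < e → r (suc f) ≤ 1) where

    private
      r-chain : ∀ {i j} → 1 ≤ i → i ≤ j → j ≤ e → r j ≤ r i
      r-chain = antitone-chain r e′ r-antitone

      gap≡0⇔∣ : ∀ j → gap j ≡ 0 ⇔ p ^ j ∣ l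
      gap≡0⇔∣ j = roundUp∸≡0⇔∣ (p ^ j) l {{m^n≢0 p j}}

      *≡0⇒≡0 : ∀ m n .{{_ : NonZero m}} → m * n ≡ 0 → n ≡ 0
      *≡0⇒≡0 m n eq = m*n≡0⇒m≡0 n m (trans (*-comm n m) eq)

    defect≡0⇒ : defect ≡ 0 → p ^ f ∣ l
    defect≡0⇒ defect≡0 with m≤n⇒m<n∨m≡n f≤e
    ... | inj₂ f≡e = subst (λ k → p ^ k ∣ l) (sym f≡e) (subst (p ^ e ∣_) pᵉ≡l ∣-refl)
      where
      instance
        rₑ∸1≢0 : NonZero (r e ∸ 1)
        rₑ∸1≢0 = >-nonZero (∸-monoˡ-≤ 1 (subst (λ k → 2 ≤ r k) f≡e (2≤r[f] (subst (1 ≤_) (sym f≡e) z<s))))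
      pᵉ≡l : p ^ e ≡ l
      pᵉ≡l = ≤-antisym (m∸n≡0⇒m≤n (*≡0⇒≡0 (r e ∸ 1) (p ^ e ∸ l) (m+n≡0⇒n≡0 _ defect≡0))) l≤pᵉ
    ... | inj₁ f<e with 1 ≤? f
    ...   | no  f≱1 = subst (λ k → p ^ k ∣ l) (sym (n<1⇒n≡0 (≰⇒> f≱1))) (1∣ l)
    ...   | yes 1≤f = Equivalence.to (gap≡0⇔∣ f) gap[f]≡0
      where
      term≡0 : Δr f * (p ^ (e ∸ f) * gap f) ≡ 0
      term≡0 = sum1to≡0⇒ e′ _ (m+n≡0⇒m≡0 _ defect≡0) f 1≤f (s≤s⁻¹ f<e)
      1≤Δr[f] : 1 ≤ Δr f
      1≤Δr[f] = ∸-mono (2≤r[f] 1≤f) (r[1+f]≤1 f<e)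
      gap[f]≡0 : gap f ≡ 0
      gap[f]≡0 = *≡0⇒≡0 (p ^ (e ∸ f)) (gap f) {{m^n≢0 p (e ∸ f)}}
                        (*≡0⇒≡0 (Δr f) _ {{>-nonZero 1≤Δr[f]}} term≡0)

    ⇒defect≡0 : p ^ f ∣ l → defect ≡ 0
    ⇒defect≡0 pᶠ∣l = cong₂ _+_ (sum1to-zero e′ _ term≡0) tail≡0
      where
      term≡0 : ∀ j → 1 ≤ j → j ≤ e′ → Δr j * (p ^ (e ∸ j) * gap j) ≡ 0
      term≡0 j 1≤j j≤e′ with j ≤? f
      ... | yes j≤f = begin
        Δr j * (p ^ (e ∸ j) * gap j) ≡⟨ cong (λ z → Δr j * (p ^ (e ∸ j) * z)) gap[j]≡0 ⟩
        Δr j * (p ^ (e ∸ j) * 0)     ≡⟨ cong (Δr j *_) (*-zeroʳ (p ^ (e ∸ j))) ⟩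
        Δr j * 0                     ≡⟨ *-zeroʳ (Δr j) ⟩
        0                            ∎
        where
        open ≡-Reasoning
        gap[j]≡0 : gap j ≡ 0
        gap[j]≡0 = Equivalence.from (gap≡0⇔∣ j) (∣-trans (^-monoʳ-∣ p j≤f) pᶠ∣l)
      ... | no  j≰f = cong (_* (p ^ (e ∸ j) * gap j)) (m≤n⇒m∸n≡0 (≤-trans r[j]≤1 1≤r[1+j]))
        where
        f<j : f < j
        f<j = ≰⇒> j≰f
        r[j]≤1 : r j ≤ 1
        r[j]≤1 = ≤-trans (r-chain (s≤s z≤n) f<j (m≤n⇒m≤1+n j≤e′)) (r[1+f]≤1 (≤-trans f<j (m≤n⇒m≤1+n j≤e′)))
        1≤r[1+j] : 1 ≤ r (suc j)
        1≤r[1+j] = ≤-trans 1≤rₑ (r-chain (s≤s z≤n) (s≤s j≤e′) ≤-refl)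
      tail≡0 : (r e ∸ 1) * (p ^ e ∸ l) ≡ 0
      tail≡0 with r e ≤? 1
      ... | yes rₑ≤1 = cong (_* (p ^ e ∸ l)) (m≤n⇒m∸n≡0 rₑ≤1)
      ... | no  rₑ≰1 = trans (cong ((r e ∸ 1) *_) (m≤n⇒m∸n≡0 (∣⇒≤ pᵉ∣l))) (*-zeroʳ (r e ∸ 1))
        where
        f≡e : f ≡ e
        f≡e with m≤n⇒m<n∨m≡n f≤e
        ... | inj₂ f≡e = f≡e
        ... | inj₁ f<e = contradiction (≤-trans (r-chain (s≤s z≤n) f<e ≤-refl) (r[1+f]≤1 f<e)) rₑ≰1
        pᵉ∣l : p ^ e ∣ l
        pᵉ∣l = subst (λ k → p ^ k ∣ l) f≡e pᶠ∣l

    defect≡0⇔∣ : defect ≡ 0 ⇔ p ^ f ∣ l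
    defect≡0⇔∣ = mk⇔ defect≡0⇒ ⇒defect≡0

-- Counting elements of Fin n

lookup-injective : ∀ {A : Set} {xs : List A} → Unique xs → ∀ i j → lookup xs i ≡ lookup xs j → i ≡ j
lookup-injective (_ ∷ _)        zero    zero    _  = refl
lookup-injective (x∉xs ∷ _)     zero    (suc j) eq = ⊥-elim (All.lookup x∉xs (∈-lookup j) eq)
lookup-injective (x∉xs ∷ _)     (suc i) zero    eq = ⊥-elim (All.lookup x∉xs (∈-lookup i) (sym eq))
lookup-injective (_ ∷ unique)   (suc i) (suc j) eq = cong suc (lookup-injective unique i j eq)

module Counting {n : ℕ} {P : Pred (Fin n) 0ℓ} (P? : Decidable P) where

  private
    xs : List (Fin n)
    xs = filter P? (allFin n)

  count : ℕ
  count = length xs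

  element : Fin count → Fin n
  element = lookup xs

  element-P : ∀ k → P (element k)
  element-P k = proj₂ (∈-filter⁻ P? {xs = allFin n} (∈-lookup k))

  element-injective : ∀ k k′ → element k ≡ element k′ → k ≡ k′
  element-injective = lookup-injective (filter⁺ P? (allFin⁺ n))

  position : ∀ x → P x → Fin count
  position x px = index (∈-filter⁺ P? (∈-allFin x) px)

  element-position : ∀ x px → element (position x px) ≡ x
  element-position x px = sym (lookup-index (∈-filter⁺ P? (∈-allFin x) px))

  injection⇒≤count : ∀ {a} (F : Fin a → Fin n) → (∀ i j → F i ≡ F j → i ≡ j) → (∀ i → P (F i)) → a ≤ count
  injection⇒≤count F F-injective F-P = injective⇒≤ {f = λ i → position (F i) (F-P i)} λ {i} {j} eq →
    F-injective i j (trans (sym (element-position (F i) (F-P i)))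
                           (trans (cong element eq) (element-position (F j) (F-P j))))

  surjection⇒count≤ : ∀ {a} (F : Fin a → Fin n) → (∀ x → P x → ∃ λ i → F i ≡ x) → count ≤ a
  surjection⇒count≤ F F-onto = injective⇒≤ {f = λ k → proj₁ (F-onto (element k) (element-P k))} λ {k} {k′} eq →
    element-injective k k′ (trans (sym (proj₂ (F-onto (element k) (element-P k))))
                                  (trans (cong F eq) (proj₂ (F-onto (element k′) (element-P k′)))))

  injection₂⇒≤count : ∀ {a b} (F : Fin a → Fin b → Fin n) →
    (∀ i j i′ j′ → F i j ≡ F i′ j′ → i ≡ i′ × j ≡ j′) → (∀ i j → P (F i j)) → a * b ≤ count
  injection₂⇒≤count {a} {b} F F-injective F-P =
    injection⇒≤count (λ k → uncurry F (remQuot {a} b k)) injective (λ k → F-P _ _)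
    where
    injective : ∀ k k′ → uncurry F (remQuot b k) ≡ uncurry F (remQuot b k′) → k ≡ k′
    injective k k′ eq with F-injective _ _ _ _ eq
    ... | i≡i′ , j≡j′ = trans (sym (combine-remQuot {a} b k)) (trans (cong₂ combine i≡i′ j≡j′) (combine-remQuot {a} b k′))

  surjection₂⇒count≤ : ∀ {a b} (F : Fin a → Fin b → Fin n) →
    (∀ x → P x → ∃ λ i → ∃ λ j → F i j ≡ x) → count ≤ a * b
  surjection₂⇒count≤ {a} {b} F F-onto = surjection⇒count≤ (λ k → uncurry F (remQuot {a} b k))
    λ x px → let (i , j , eq) = F-onto x px in combine i j , trans (cong (uncurry F) (remQuot-combine i j)) eq

count<⇒∃ : ∀ {n} {P Q : Pred (Fin n) 0ℓ} (P? : Decidable P) (Q? : Decidable Q) →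
           Counting.count Q? < Counting.count P? → ∃ λ x → P x × ¬ Q x
count<⇒∃ {Q = Q} P? Q? Q<P with any? (λ x → P? x ×-dec ¬? (Q? x))
... | yes found = found
... | no  none  = ⊥-elim (<⇒≱ Q<P (Q.injection⇒≤count P.element P.element-injective element-Q))
  where
  module P = Counting P?
  module Q = Counting Q?
  element-Q : ∀ k → Q (P.element k)
  element-Q k with Q? (P.element k)
  ... | yes q = q
  ... | no ¬q = ⊥-elim (none (P.element k , P.element-P k , ¬q))

-- The subgroups mG

module MultipleSubgroups (G : FinAbGroup) where

  open FinAbGroup G using (order; _∙_; e0; _⁻¹; isAbelianGroup; _·_; _∈mul_; _∈mul?_)

  abelianGroup : AbelianGroup 0ℓ 0ℓ
  abelianGroup = record
    { Carrier = Fin order ; _≈_ = _≡_ ; _∙_ = _∙_ ; ε = e0 ; _⁻¹ = _⁻¹ ; isAbelianGroup = isAbelianGroup }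

  open AbelianGroup abelianGroup using (assoc; comm; identityˡ; identityʳ; inverseˡ)
  open import Algebra.Properties.AbelianGroup abelianGroup using (∙-cancelˡ; inverseˡ-unique; x≈z//y; \\-leftDividesˡ)
  open import Algebra.Properties.CommutativeMonoid.Mult (AbelianGroup.commutativeMonoid abelianGroup)
    using (×-homo-+; ×-assocˡ; ×-distrib-+)
    renaming (_×_ to _×ᴹ_)

  ·≗× : ∀ k x → k · x ≡ k ×ᴹ x
  ·≗× zero    x = refl
  ·≗× (suc k) x = cong (x ∙_) (·≗× k x)

  ·-homo-+ : ∀ m n x → (m + n) · x ≡ (m · x) ∙ (n · x)
  ·-homo-+ m n x rewrite ·≗× (m + n) x | ·≗× m x | ·≗× n x = ×-homo-+ x m n

  ·-assoc : ∀ m n x → (m * n) · x ≡ m · (n · x)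
  ·-assoc m n x rewrite ·≗× (m * n) x | ·≗× n x | ·≗× m (n ×ᴹ x) = sym (×-assocˡ x m n)

  ·-distrib-∙ : ∀ k x y → k · (x ∙ y) ≡ (k · x) ∙ (k · y)
  ·-distrib-∙ k x y rewrite ·≗× k (x ∙ y) | ·≗× k x | ·≗× k y = ×-distrib-+ x y k

  ·-comm : ∀ m n x → m · (n · x) ≡ n · (m · x)
  ·-comm m n x = trans (sym (·-assoc m n x)) (trans (cong (_· x) (*-comm m n)) (·-assoc n m x))

  ·-ε : ∀ k → k · e0 ≡ e0
  ·-ε zero    = refl
  ·-ε (suc k) = trans (cong (e0 ∙_) (·-ε k)) (identityˡ e0)

  ·-⁻¹ : ∀ k x → k · (x ⁻¹) ≡ (k · x) ⁻¹
  ·-⁻¹ k x = inverseˡ-unique (k · (x ⁻¹)) (k · x)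
    (trans (sym (·-distrib-∙ k (x ⁻¹) x)) (trans (cong (k ·_) (inverseˡ x)) (·-ε k)))

  ε-∈mul : ∀ m → e0 ∈mul m
  ε-∈mul m = e0 , sym (·-ε m)

  ∙-∈mul : ∀ m {x y} → x ∈mul m → y ∈mul m → (x ∙ y) ∈mul m
  ∙-∈mul m (a , refl) (b , refl) = a ∙ b , sym (·-distrib-∙ m a b)

  ⁻¹-∈mul : ∀ m {x} → x ∈mul m → (x ⁻¹) ∈mul m
  ⁻¹-∈mul m (a , refl) = a ⁻¹ , sym (·-⁻¹ m a)

  ·-∈mul : ∀ m k {x} → x ∈mul m → (k · x) ∈mul m
  ·-∈mul m k (a , refl) = k · a , ·-comm k m a

  ∈mul-*⇒∈mul : ∀ a m {x} → x ∈mul (a * m) → x ∈mul m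
  ∈mul-*⇒∈mul a m (y , refl) = a · y , trans (·-assoc a m y) (·-comm a m y)

  ·-∈mul-* : ∀ a m {x} → x ∈mul m → (a · x) ∈mul (a * m)
  ·-∈mul-* a m (y , refl) = y , sym (·-assoc a m y)

  suc-·-∈mul : ∀ n u v {g} → suc u ≡ v → (u · g) ∈mul n → (v · g) ∈mul n → g ∈mul n
  suc-·-∈mul n u v {g} 1+u≡v u·g∈ v·g∈ =
    subst (_∈mul n) (sym (x≈z//y g (u · g) (v · g) (cong (_· g) 1+u≡v))) (∙-∈mul n v·g∈ (⁻¹-∈mul n u·g∈))

  *-·-∈mul : ∀ n x c {g} → (c · g) ∈mul n → ((x * c) · g) ∈mul n
  *-·-∈mul n x c {g} c·g∈ = subst (_∈mul n) (sym (·-assoc x c g)) (·-∈mul n x c·g∈)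

  coprime-·-∈mul : ∀ n a d {g} → Coprime a d → (a · g) ∈mul n → (d · g) ∈mul n → g ∈mul n
  coprime-·-∈mul n a d a⊥d a·g∈ d·g∈ with coprime-Bézout a⊥d
  ... | Bézout.+- x y 1+yd≡xa = suc-·-∈mul n (y * d) (x * a) 1+yd≡xa (*-·-∈mul n y d d·g∈) (*-·-∈mul n x a a·g∈)
  ... | Bézout.-+ x y 1+xa≡yd = suc-·-∈mul n (x * a) (y * d) 1+xa≡yd (*-·-∈mul n x a a·g∈) (*-·-∈mul n y d d·g∈)

  module Card (m : ℕ) = Counting (_∈mul? m)

  1≤cardMul : ∀ m → 1 ≤ cardMul G m
  1≤cardMul m = Card.injection⇒≤count m {1} (λ _ → e0) (λ { zero zero _ → refl }) (λ _ → ε-∈mul m)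

  cardMul≤1 : ∀ m → (∀ x → m · x ≡ e0) → cardMul G m ≤ 1
  cardMul≤1 m m-kills = Card.surjection⇒count≤ m {1} (λ _ → e0) λ { x (y , refl) → zero , sym (m-kills y) }

  ∈mul∧≢ε⇒2≤cardMul : ∀ m {x} → x ∈mul m → x ≢ e0 → 2 ≤ cardMul G m
  ∈mul∧≢ε⇒2≤cardMul m {x} x∈mG x≢ε = Card.injection⇒≤count m F F-injective F-∈mul
    where
    F : Fin 2 → Fin order
    F zero       = e0
    F (suc zero) = x
    F-injective : ∀ i j → F i ≡ F j → i ≡ j
    F-injective zero       zero       _  = refl
    F-injective zero       (suc zero) eq = ⊥-elim (x≢ε (sym eq))
    F-injective (suc zero) zero       eq = ⊥-elim (x≢ε eq)
    F-injective (suc zero) (suc zero) _  = refl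
    F-∈mul : ∀ i → F i ∈mul m
    F-∈mul zero       = ε-∈mul m
    F-∈mul (suc zero) = x∈mG

  Torsion : ℕ → ℕ → Fin order → Set
  Torsion a m x = x ∈mul m × a · x ≡ e0

  torsion? : ∀ a m → Decidable (Torsion a m)
  torsion? a m x = (x ∈mul? m) ×-dec (a · x ≟ e0)

  module Tor (a m : ℕ) = Counting (torsion? a m)

  torsionCount : ℕ → ℕ → ℕ
  torsionCount a m = Tor.count a m

  cardMul≡cardMul*torsionCount : ∀ a m → cardMul G m ≡ cardMul G (a * m) * torsionCount a m
  cardMul≡cardMul*torsionCount a m =
    ≤-antisym (Card.surjection₂⇒count≤ m Φ Φ-onto) (Card.injection₂⇒≤count m Φ Φ-injective Φ-∈mul)
    where
    module A = Card (a * m)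
    module T = Tor a m

    lift : Fin A.count → Fin order
    lift i = m · proj₁ (A.element-P i)

    a·lift : ∀ i → a · lift i ≡ A.element i
    a·lift i = trans (sym (·-assoc a m (proj₁ (A.element-P i)))) (sym (proj₂ (A.element-P i)))

    Φ : Fin A.count → Fin T.count → Fin order
    Φ i j = lift i ∙ T.element j

    a·Φ : ∀ i j → a · Φ i j ≡ A.element i
    a·Φ i j = begin
      a · (lift i ∙ T.element j)         ≡⟨ ·-distrib-∙ a (lift i) (T.element j) ⟩
      (a · lift i) ∙ (a · T.element j)   ≡⟨ cong₂ _∙_ (a·lift i) (proj₂ (T.element-P j)) ⟩
      A.element i ∙ e0                   ≡⟨ identityʳ (A.element i) ⟩
      A.element i                        ∎
      where open ≡-Reasoning

    Φ-∈mul : ∀ i j → Φ i j ∈mul m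
    Φ-∈mul i j = ∙-∈mul m (proj₁ (A.element-P i) , refl) (proj₁ (T.element-P j))

    Φ-injective : ∀ i j i′ j′ → Φ i j ≡ Φ i′ j′ → i ≡ i′ × j ≡ j′
    Φ-injective i j i′ j′ eq with A.element-injective i i′ (trans (sym (a·Φ i j)) (trans (cong (a ·_) eq) (a·Φ i′ j′)))
    ... | refl = refl , T.element-injective j j′ (∙-cancelˡ (lift i) _ _ eq)

    Φ-onto : ∀ x → x ∈mul m → ∃ λ i → ∃ λ j → Φ i j ≡ x
    Φ-onto x x∈mG = i , T.position t t-torsion , trans (cong (lift i ∙_) (T.element-position t t-torsion)) lift∙t≡x
      where
      i : Fin A.count
      i = A.position (a · x) (·-∈mul-* a m x∈mG)
      t : Fin order
      t = (lift i ⁻¹) ∙ x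
      lift∙t≡x : lift i ∙ t ≡ x
      lift∙t≡x = \\-leftDividesˡ (lift i) x
      t-torsion : Torsion a m t
      t-torsion = ∙-∈mul m (⁻¹-∈mul m (proj₁ (A.element-P i) , refl)) x∈mG , (begin
        a · ((lift i ⁻¹) ∙ x)          ≡⟨ ·-distrib-∙ a (lift i ⁻¹) x ⟩
        (a · (lift i ⁻¹)) ∙ (a · x)    ≡⟨ cong (_∙ (a · x)) (·-⁻¹ a (lift i)) ⟩
        ((a · lift i) ⁻¹) ∙ (a · x)    ≡⟨ cong (λ z → (z ⁻¹) ∙ (a · x)) (trans (a·lift i) (A.element-position (a · x) _)) ⟩
        ((a · x) ⁻¹) ∙ (a · x)         ≡⟨ inverseˡ (a · x) ⟩
        e0                             ∎)
        where open ≡-Reasoning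

  torsionCount-antitone : ∀ a b m → torsionCount a (b * m) ≤ torsionCount a m
  torsionCount-antitone a b m = Tor.injection⇒≤count a m (Tor.element a (b * m)) (Tor.element-injective a (b * m))
    λ k → let (x∈bmG , a·x≡ε) = Tor.element-P a (b * m) k in ∈mul-*⇒∈mul b m x∈bmG , a·x≡ε

  cyclic⇒cardMul≤ : ∀ a m .{{_ : NonZero a}} → MulCyclic G m → cardMul G m ≤ a * cardMul G (a * m)
  cyclic⇒cardMul≤ a m (g , g∈mG , generates) = Card.surjection₂⇒count≤ m Ψ Ψ-onto
    where
    module A = Card (a * m)

    Ψ : Fin a → Fin A.count → Fin order
    Ψ c j = (toℕ c · g) ∙ A.element j

    Ψ-onto : ∀ x → x ∈mul m → ∃ λ c → ∃ λ j → Ψ c j ≡ x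
    Ψ-onto x x∈mG with generates x x∈mG
    ... | k , x≡k·g = fromℕ< (m%n<n k a) , A.position h h∈amG , (begin
      (toℕ (fromℕ< (m%n<n k a)) · g) ∙ A.element (A.position h h∈amG)
                                        ≡⟨ cong₂ _∙_ (cong (_· g) (toℕ-fromℕ< (m%n<n k a))) (A.element-position h h∈amG) ⟩
      ((k % a) · g) ∙ (((k / a) * a) · g) ≡⟨ ·-homo-+ (k % a) ((k / a) * a) g ⟨
      (k % a + (k / a) * a) · g         ≡⟨ cong (_· g) (m≡m%n+[m/n]*n k a) ⟨
      k · g                             ≡⟨ x≡k·g ⟨
      x                                 ∎)
      where
      open ≡-Reasoning
      h : Fin order
      h = ((k / a) * a) · g
      h∈amG : h ∈mul (a * m)
      h∈amG = *-·-∈mul (a * m) (k / a) a (·-∈mul-* a m g∈mG)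

  -- Choose g ∈ mG ∖ pmG. By Bézout the p cosets c·g + pmG (c < p) are disjoint, so by counting they
  -- exhaust mG; iterating, mG = ⟨g⟩ + pᵏmG for every k, and pᵉ kills G.
  module _ {p : ℕ} (prime : Prime p) (e : ℕ) (pᵉ-kills : ∀ x → (p ^ e) · x ≡ e0) (m : ℕ)
           (index-p : cardMul G m ≡ p * cardMul G (p * m)) where

    private
      instance
        p≢0 : NonZero p
        p≢0 = prime⇒nonZero prime

      module PM = Card (p * m)

      1<p : 1 < p
      1<p = nonTrivial⇒n>1 p {{prime⇒nonTrivial prime}}

      cardMul[pm]<cardMul[m] : cardMul G (p * m) < cardMul G m
      cardMul[pm]<cardMul[m] = <-≤-trans (m<m*n (cardMul G (p * m)) p {{>-nonZero (1≤cardMul (p * m))}} 1<p)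
                                         (≤-reflexive (trans (*-comm _ p) (sym index-p)))

      generator : ∃ λ g → g ∈mul m × ¬ g ∈mul (p * m)
      generator = count<⇒∃ (_∈mul? m) (_∈mul? (p * m)) cardMul[pm]<cardMul[m]

      g : Fin order
      g = proj₁ generator
      g∈mG : g ∈mul m
      g∈mG = proj₁ (proj₂ generator)
      g∉pmG : ¬ g ∈mul (p * m)
      g∉pmG = proj₂ (proj₂ generator)

      cosets-disjoint : ∀ a b {h h′} → a < b → b < p → h ∈mul (p * m) → h′ ∈mul (p * m) →
                        (a · g) ∙ h ≢ (b · g) ∙ h′
      cosets-disjoint a b {h} {h′} a<b b<p h∈ h′∈ eq =
        g∉pmG (coprime-·-∈mul (p * m) p d p⊥d (·-∈mul-* p m g∈mG) d·g∈pmG)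
        where
        d : ℕ
        d = b ∸ a
        instance
          d≢0 : NonZero d
          d≢0 = >-nonZero (m<n⇒0<n∸m a<b)
        p⊥d : Coprime p d
        p⊥d = prime⇒coprime prime (≤-<-trans (m∸n≤m b a) b<p)
        h≡d·g∙h′ : h ≡ (d · g) ∙ h′
        h≡d·g∙h′ = ∙-cancelˡ (a · g) h ((d · g) ∙ h′) (begin
          (a · g) ∙ h                   ≡⟨ eq ⟩
          (b · g) ∙ h′                  ≡⟨ cong (λ k → (k · g) ∙ h′) (m∸n+n≡m (<⇒≤ a<b)) ⟨
          ((d + a) · g) ∙ h′            ≡⟨ cong (_∙ h′) (trans (·-homo-+ d a g) (comm (d · g) (a · g))) ⟩
          ((a · g) ∙ (d · g)) ∙ h′      ≡⟨ assoc (a · g) (d · g) h′ ⟩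
          (a · g) ∙ ((d · g) ∙ h′)      ∎)
          where open ≡-Reasoning
        d·g∈pmG : (d · g) ∈mul (p * m)
        d·g∈pmG = subst (_∈mul (p * m)) (sym (x≈z//y (d · g) h′ h (sym h≡d·g∙h′)))
                        (∙-∈mul (p * m) h∈ (⁻¹-∈mul (p * m) h′∈))

      mG⊆⟨g⟩+pmG : ∀ x → x ∈mul m → ∃ λ c → ∃ λ y → x ≡ (c · g) ∙ ((p * m) · y)
      mG⊆⟨g⟩+pmG x x∈mG with any? (λ (c : Fin p) → any? (λ y → x ≟ (toℕ c · g) ∙ ((p * m) · y)))
      ... | yes (c , y , eq) = toℕ c , y , eq
      ... | no  uncovered    = contradiction (Card.injection₂⇒≤count m Φ Φ-injective Φ-∈mul) too-many
        where
        coset : Fin (suc p) → Fin order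
        coset zero    = x
        coset (suc c) = toℕ c · g

        coset-∈mul : ∀ c → coset c ∈mul m
        coset-∈mul zero    = x∈mG
        coset-∈mul (suc c) = ·-∈mul m (toℕ c) g∈mG

        Φ : Fin (suc p) → Fin PM.count → Fin order
        Φ c j = coset c ∙ PM.element j

        Φ-∈mul : ∀ c j → Φ c j ∈mul m
        Φ-∈mul c j = ∙-∈mul m (coset-∈mul c) (∈mul-*⇒∈mul p m (PM.element-P j))

        x∉coset : ∀ c {h h′} → h ∈mul (p * m) → h′ ∈mul (p * m) → x ∙ h ≢ (toℕ c · g) ∙ h′
        x∉coset c {h} {h′} h∈ h′∈ eq with ∙-∈mul (p * m) h′∈ (⁻¹-∈mul (p * m) h∈)
        ... | y , h′∙h⁻¹≡pm·y = uncovered (c , y , trans x≡ (cong ((toℕ c · g) ∙_) h′∙h⁻¹≡pm·y))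
          where
          x≡ : x ≡ (toℕ c · g) ∙ (h′ ∙ (h ⁻¹))
          x≡ = trans (x≈z//y x h _ eq) (assoc (toℕ c · g) h′ (h ⁻¹))

        Φ-injective : ∀ c j c′ j′ → Φ c j ≡ Φ c′ j′ → c ≡ c′ × j ≡ j′
        Φ-injective zero    j zero     j′ eq = refl , PM.element-injective j j′ (∙-cancelˡ x _ _ eq)
        Φ-injective zero    j (suc c′) j′ eq = ⊥-elim (x∉coset c′ (PM.element-P j) (PM.element-P j′) eq)
        Φ-injective (suc c) j zero     j′ eq = ⊥-elim (x∉coset c (PM.element-P j′) (PM.element-P j) (sym eq))
        Φ-injective (suc c) j (suc c′) j′ eq with <-cmp (toℕ c) (toℕ c′)
        ... | tri< c<c′ _ _ = ⊥-elim (cosets-disjoint _ _ c<c′ (toℕ<n c′) (PM.element-P j) (PM.element-P j′) eq)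
        ... | tri> _ _ c′<c = ⊥-elim (cosets-disjoint _ _ c′<c (toℕ<n c) (PM.element-P j′) (PM.element-P j) (sym eq))
        ... | tri≈ _ c≡c′ _ with toℕ-injective c≡c′
        ...   | refl = refl , PM.element-injective j j′ (∙-cancelˡ (toℕ c · g) _ _ eq)

        too-many : ¬ (suc p * cardMul G (p * m) ≤ cardMul G m)
        too-many = <⇒≱ (≤-trans (≤-reflexive (cong suc index-p)) (+-monoˡ-≤ (p * cardMul G (p * m)) (1≤cardMul (p * m))))

      mG⊆⟨g⟩+pᵏmG : ∀ k x → x ∈mul m → ∃ λ c → ∃ λ z → x ≡ (c · g) ∙ ((p ^ k * m) · z)
      mG⊆⟨g⟩+pᵏmG zero    x (z , x≡m·z) =
        0 , z , trans x≡m·z (trans (cong (_· z) (sym (*-identityˡ m))) (sym (identityˡ _)))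
      mG⊆⟨g⟩+pᵏmG (suc k) x x∈mG with mG⊆⟨g⟩+pᵏmG k x x∈mG
      ... | c , z , x≡ with mG⊆⟨g⟩+pmG (m · z) (z , refl)
      ...   | c′ , y , m·z≡ = c + p ^ k * c′ , y , (begin
        x                                                        ≡⟨ x≡ ⟩
        (c · g) ∙ ((p ^ k * m) · z)                              ≡⟨ cong ((c · g) ∙_) pᵏm·z≡ ⟩
        (c · g) ∙ (((p ^ k * c′) · g) ∙ ((p ^ suc k * m) · y))   ≡⟨ assoc _ _ _ ⟨
        ((c · g) ∙ ((p ^ k * c′) · g)) ∙ ((p ^ suc k * m) · y)
          ≡⟨ cong (_∙ ((p ^ suc k * m) · y)) (·-homo-+ c (p ^ k * c′) g) ⟨
        ((c + p ^ k * c′) · g) ∙ ((p ^ suc k * m) · y)           ∎)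
        where
        open ≡-Reasoning
        pᵏm·z≡ : (p ^ k * m) · z ≡ ((p ^ k * c′) · g) ∙ ((p ^ suc k * m) · y)
        pᵏm·z≡ = begin
          (p ^ k * m) · z                                    ≡⟨ ·-assoc (p ^ k) m z ⟩
          (p ^ k) · (m · z)                                  ≡⟨ cong ((p ^ k) ·_) m·z≡ ⟩
          (p ^ k) · ((c′ · g) ∙ ((p * m) · y))               ≡⟨ ·-distrib-∙ (p ^ k) _ _ ⟩
          ((p ^ k) · (c′ · g)) ∙ ((p ^ k) · ((p * m) · y))
            ≡⟨ cong₂ _∙_ (·-assoc (p ^ k) c′ g) (·-assoc (p ^ k) (p * m) y) ⟨
          ((p ^ k * c′) · g) ∙ ((p ^ k * (p * m)) · y)       ≡⟨ cong (λ n → ((p ^ k * c′) · g) ∙ (n · y)) pᵏ*[p*m]≡ ⟩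
          ((p ^ k * c′) · g) ∙ ((p ^ suc k * m) · y)         ∎
          where
          pᵏ*[p*m]≡ : p ^ k * (p * m) ≡ p ^ suc k * m
          pᵏ*[p*m]≡ = trans (sym (*-assoc (p ^ k) p m)) (cong (_* m) (*-comm (p ^ k) p))

    index-p⇒cyclic : MulCyclic G m
    index-p⇒cyclic = g , g∈mG , λ x x∈mG → let (c , z , x≡) = mG⊆⟨g⟩+pᵏmG e x x∈mG in c , (begin
      x                              ≡⟨ x≡ ⟩
      (c · g) ∙ ((p ^ e * m) · z)    ≡⟨ cong ((c · g) ∙_) (trans (·-assoc (p ^ e) m z) (pᵉ-kills (m · z))) ⟩
      (c · g) ∙ e0                   ≡⟨ identityʳ (c · g) ⟩
      c · g                          ∎)
      where open ≡-Reasoning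

  module PGroup {p : ℕ} (prime : Prime p) (e′ : ℕ) (exponent : HasExponent G (p ^ suc e′)) (r : ℕ → ℕ)
                (index : ∀ i → 1 ≤ i → i ≤ suc e′ → cardMul G (p ^ (i ∸ 1)) ≡ p ^ r i * cardMul G (p ^ i)) where

    private
      e : ℕ
      e = suc e′

      instance
        p≢0 : NonZero p
        p≢0 = prime⇒nonZero prime

      1<p : 1 < p
      1<p = nonTrivial⇒n>1 p {{prime⇒nonTrivial prime}}

      cardMul≢0 : ∀ m → NonZero (cardMul G m)
      cardMul≢0 m = >-nonZero (1≤cardMul m)

    pʳ≡torsionCount : ∀ i → i ≤ e′ → p ^ r (suc i) ≡ torsionCount p (p ^ i)
    pʳ≡torsionCount i i≤e′ = *-cancelʳ-≡ _ _ (cardMul G (p ^ suc i)) {{cardMul≢0 (p ^ suc i)}} (begin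
      p ^ r (suc i) * cardMul G (p ^ suc i)       ≡⟨ index (suc i) (s≤s z≤n) (s≤s i≤e′) ⟨
      cardMul G (p ^ i)                           ≡⟨ cardMul≡cardMul*torsionCount p (p ^ i) ⟩
      cardMul G (p ^ suc i) * torsionCount p (p ^ i) ≡⟨ *-comm (cardMul G (p ^ suc i)) _ ⟩
      torsionCount p (p ^ i) * cardMul G (p ^ suc i) ∎)
      where open ≡-Reasoning

    r-antitone : ∀ j → 1 ≤ j → j ≤ e′ → r (suc j) ≤ r j
    r-antitone (suc i) _ 1+i≤e′ = ^-cancelʳ-≤ p 1<p (begin
      p ^ r (suc (suc i))            ≡⟨ pʳ≡torsionCount (suc i) 1+i≤e′ ⟩
      torsionCount p (p * p ^ i)     ≤⟨ torsionCount-antitone p p (p ^ i) ⟩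
      torsionCount p (p ^ i)         ≡⟨ pʳ≡torsionCount i (<⇒≤ 1+i≤e′) ⟨
      p ^ r (suc i)                  ∎)
      where open ≤-Reasoning

    1≤r[e] : 1 ≤ r e
    1≤r[e] = n≢0⇒n>0 λ r[e]≡0 → <⇒≱ 2≤cardMul[pᵉ′] (begin
      cardMul G (p ^ e′)                ≡⟨ index e (s≤s z≤n) ≤-refl ⟩
      p ^ r e * cardMul G (p ^ e)       ≡⟨ cong (λ k → p ^ k * cardMul G (p ^ e)) r[e]≡0 ⟩
      1 * cardMul G (p ^ e)             ≡⟨ *-identityˡ _ ⟩
      cardMul G (p ^ e)                 ≤⟨ cardMul≤1 (p ^ e) (proj₁ exponent) ⟩
      1                                 ∎)
      where
      open ≤-Reasoning
      pᵉ′-does-not-kill : ¬ (∀ y → (p ^ e′) · y ≡ e0)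
      pᵉ′-does-not-kill kills = <⇒≱ (^-monoʳ-< p 1<p (n<1+n e′)) (proj₂ exponent (p ^ e′) (m^n>0 p e′) kills)
      survivor : ∃ λ y → (p ^ e′) · y ≢ e0
      survivor = ¬∀⟶∃¬ order _ (λ y → (p ^ e′) · y ≟ e0) pᵉ′-does-not-kill
      2≤cardMul[pᵉ′] : 2 ≤ cardMul G (p ^ e′)
      2≤cardMul[pᵉ′] = ∈mul∧≢ε⇒2≤cardMul (p ^ e′) (proj₁ survivor , refl) (proj₂ survivor)

    cyclic⇒r≤1 : ∀ f → f < e → MulCyclic G (p ^ f) → r (suc f) ≤ 1
    cyclic⇒r≤1 f f<e cyclic =
      ^-cancelʳ-≤ p 1<p (*-cancelʳ-≤ _ _ (cardMul G (p ^ suc f)) {{cardMul≢0 (p ^ suc f)}} (begin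
      p ^ r (suc f) * cardMul G (p ^ suc f)   ≡⟨ index (suc f) (s≤s z≤n) f<e ⟨
      cardMul G (p ^ f)                       ≤⟨ cyclic⇒cardMul≤ p (p ^ f) cyclic ⟩
      p * cardMul G (p ^ suc f)               ≡⟨ cong (_* cardMul G (p ^ suc f)) (*-identityʳ p) ⟨
      p ^ 1 * cardMul G (p ^ suc f)           ∎))
      where open ≤-Reasoning

    minimal⇒2≤r : ∀ f → 1 ≤ f → f ≤ e → (∀ f′ → f′ < f → ¬ MulCyclic G (p ^ f′)) → 2 ≤ r f
    minimal⇒2≤r (suc f′) _ f≤e minimal with 2 ≤? r (suc f′)
    ... | yes 2≤r = 2≤r
    ... | no  2≰r = contradiction (index-p⇒cyclic prime e (proj₁ exponent) (p ^ f′) index-p) (minimal f′ ≤-refl)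
      where
      r≡1 : r (suc f′) ≡ 1
      r≡1 = ≤-antisym (s≤s⁻¹ (≰⇒> 2≰r)) (≤-trans 1≤r[e] (antitone-chain r e′ r-antitone (s≤s z≤n) f≤e ≤-refl))
      index-p : cardMul G (p ^ f′) ≡ p * cardMul G (p * p ^ f′)
      index-p = trans (index (suc f′) (s≤s z≤n) f≤e)
                      (cong (_* cardMul G (p * p ^ f′)) (trans (cong (p ^_) r≡1) (*-identityʳ p)))

proposition6p4 : (p : ℕ) → Prime p → (G : FinAbGroup) → (e : ℕ) → 1 ≤ e
    → HasExponent G (p ^ e)
    → (r : ℕ → ℕ) → (∀ i → 1 ≤ i → i ≤ e → cardMul G (p ^ (i ∸ 1)) ≡ p ^ r i * cardMul G (p ^ i))
    → (f : ℕ) → f ≤ e → MulCyclic G (p ^ f) → (∀ f′ → f′ < f → ¬ MulCyclic G (p ^ f′))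
    → (l : ℕ) → 2 ≤ l → l ≤ p ^ e
    → (0ℚ ℚ.≤ εfun p e r l) × (εfun p e r l ≡ 0ℚ ⇔ (p ^ f ∣ l))
proposition6p4 p p-prime G (suc e′) (s≤s z≤n) exponent r index f f≤e cyclic minimal l 2≤l l≤pᵉ =
  subst (0ℚ ℚ.≤_) (sym εfun≡defect÷pᵉl) (÷-nonNeg defect (p ^ e * l)) ,
  subst (λ ε → ε ≡ 0ℚ ⇔ p ^ f ∣ l) (sym εfun≡defect÷pᵉl)
        (defect≡0⇔∣ f f≤e 2≤r[f] r[1+f]≤1 ⇔-∘ ÷≡0⇔≡0 defect (p ^ e * l))
  where
  instance
    p≢0 : NonZero p
    p≢0 = prime⇒nonZero p-prime
    l≢0 : NonZero l
    l≢0 = >-nonZero (≤-trans (s≤s z≤n) 2≤l)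
    pᵉl≢0 : NonZero (p ^ suc e′ * l)
    pᵉl≢0 = m*n≢0 (p ^ suc e′) l {{m^n≢0 p (suc e′)}}

  open MultipleSubgroups G using (module PGroup)
  open PGroup p-prime e′ exponent r index
  open Defect p e′ l l≤pᵉ r r-antitone 1≤r[e]

  2≤r[f] : 1 ≤ f → 2 ≤ r f
  2≤r[f] 1≤f = minimal⇒2≤r f 1≤f f≤e minimal

  r[1+f]≤1 : f < e → r (suc f) ≤ 1
  r[1+f]≤1 f<e = cyclic⇒r≤1 f f<e cyclic
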